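{- Let $\mathcal{G}$ be a connected RCOP block graph. Then every shortest path in $\mathcal{G}$ contains at most two vertices of any given color.
   Context: A colored graph $\mathcal{G}$ is a finite simple undirected graph on vertex set $[n]$ with a coloring $\lambda$ of its vertices and edges; $\Gamma(\mathcal{G})$ is the group of graph automorphisms preserving all vertex and edge colors. $\mathcal{G}$ is RCOP if the vertex colors and edge colors form disjoint sets, any two same-colored vertices are mapped to one another by some element of $\Gamma(\mathcal{G})$, and any two same-colored edges are mapped to one another by some element of $\Gamma(\mathcal{G})$. A graph on $[n]$ is a block graph if there is a vertex $c$ and a partition of $[n]$ into disjoint sets $A,B,\{c\}$ such that every path from $A$ to $B$ contains $c$, and the induced subgraphs on $A\cup\{c\}$ and $B\cup\{c\}$ are each complete graphs or block graphs. In a connected block graph any two vertices are joined by a unique shortest path. -}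

module Defs where

open import Data.Nat using (ℕ; _≤_)
open import Data.Fin using (Fin)
open import Data.Fin.Subset using (Subset; _∈_; _∉_; _∪_; ⁅_⁆; ⊤)
open import Data.Bool using (Bool; true)
open import Data.Maybe using (just)
open import Data.List using (List; head; last; length)
open import Data.List.Relation.Unary.All using (All)
open import Data.List.Relation.Unary.Linked using (Linked)
open import Data.List.Membership.Propositional using () renaming (_∈_ to _∈ₗ_)
open import Data.List.Relation.Unary.Unique.Propositional using (Unique)
open import Data.Product using (Σ; ∃; _×_; _,_)
open import Data.Sum using (_⊎_)
open import Function.Bundles using (_↔_; Inverse)
open import Relation.Binary.PropositionalEquality using (_≡_; _≢_)

-- Vertex colors: vcol; edge colors: ecol,
-- which is only meaningful (and required symmetric) on edges.
record ColoredGraph (n : ℕ) (C : Set) : Set where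
  field
    adj       : Fin n → Fin n → Bool
    adj-sym   : ∀ i j → adj i j ≡ adj j i
    adj-irr   : ∀ i → adj i i ≢ true
    vcol      : Fin n → C
    ecol      : Fin n → Fin n → C
    ecol-sym  : ∀ i j → adj i j ≡ true → ecol i j ≡ ecol j i

  Adj : Fin n → Fin n → Set
  Adj i j = adj i j ≡ true

open ColoredGraph public

module _ {n : ℕ} {C : Set} (G : ColoredGraph n C) where

  IsColorAut : (Fin n ↔ Fin n) → Set
  IsColorAut σ =
    (∀ i j → adj G (f i) (f j) ≡ adj G i j) ×
    (∀ v → vcol G (f v) ≡ vcol G v) ×
    (∀ i j → Adj G i j → ecol G (f i) (f j) ≡ ecol G i j)
    where f = Inverse.to σ

  Aut : Set
  Aut = Σ (Fin n ↔ Fin n) IsColorAut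

  RCOP : Set
  RCOP =
    (∀ v i j → Adj G i j → vcol G v ≢ ecol G i j) ×
    (∀ u v → vcol G u ≡ vcol G v →
       Σ Aut λ { (σ , _) → Inverse.to σ u ≡ v }) ×
    (∀ i j k l → Adj G i j → Adj G k l → ecol G i j ≡ ecol G k l →
       Σ Aut λ { (σ , _) →
         (Inverse.to σ i ≡ k × Inverse.to σ j ≡ l) ⊎
         (Inverse.to σ i ≡ l × Inverse.to σ j ≡ k) })

  IsPath : Fin n → Fin n → List (Fin n) → Set
  IsPath u v p =
    head p ≡ just u × last p ≡ just v × Linked (Adj G) p × Unique p

  IsPathIn : Subset n → Fin n → Fin n → List (Fin n) → Set
  IsPathIn S u v p = IsPath u v p × All (_∈ S) p

  Connected : Set
  Connected = ∀ u v → ∃ λ p → IsPath u v p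

  IsShortestPath : Fin n → Fin n → List (Fin n) → Set
  IsShortestPath u v p =
    IsPath u v p × (∀ q → IsPath u v q → length p ≤ length q)

  CompleteOn : Subset n → Set
  CompleteOn S = ∀ u v → u ∈ S → v ∈ S → u ≢ v → Adj G u v

  SplitsAs : Subset n → Subset n → Subset n → Fin n → Set
  SplitsAs S A B c =
    c ∈ S × c ∉ A × c ∉ B ×
    (∀ x → x ∈ A → x ∉ B) ×
    (∀ x → x ∈ S → (x ∈ A ⊎ x ∈ B ⊎ x ≡ c)) ×
    (∀ x → x ∈ A → x ∈ S) × (∀ x → x ∈ B → x ∈ S)

  data BlockOn (S : Subset n) : Set where
    split : (A B : Subset n) (c : Fin n) →
      SplitsAs S A B c →
      (∀ a b p → a ∈ A → b ∈ B → IsPathIn S a b p → c ∈ₗ p) →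
      (CompleteOn (A ∪ ⁅ c ⁆) ⊎ BlockOn (A ∪ ⁅ c ⁆)) →
      (CompleteOn (B ∪ ⁅ c ⁆) ⊎ BlockOn (B ∪ ⁅ c ⁆)) →
      BlockOn S

  IsBlockGraph : Set
  IsBlockGraph = BlockOn ⊤

-- In a block graph the distance to a fixed vertex w is strictly quasiconvex
-- along geodesics: an interior vertex y of a geodesic from x to z satisfies
-- d(y, w) < max (d(x, w), d(z, w)).  This goes by induction on the block
-- decomposition, since every walk between the two sides of a cut vertex c
-- passes through c.  Now let x, y, z be three vertices of one colour on a
-- shortest path, y between x and z.  By RCOP some automorphisms carry y to x
-- and to z, so ecc(x) = ecc(y) = ecc(z); quasiconvexity gives
-- ecc(y) < max (ecc(x), ecc(z)), a contradiction.
module Submission where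

open import Defs
open import Data.Nat using (ℕ; zero; suc; _+_; _≤_; _<_; z≤n; s≤s; _⊔_)
open import Data.Nat.Properties hiding (_≟_)
open import Data.Fin using (Fin; zero; suc; _≟_)
open import Data.Fin.Subset using (Subset; _∪_; ⁅_⁆; ⊤; _⊆_)
  renaming (_∈_ to _∈ₛ_; _∉_ to _∉ₛ_)
open import Data.Fin.Subset.Properties using (x∈p∪q⁻; x∈p∪q⁺; x∈⁅x⁆; x∈⁅y⁆⇒x≡y; ∈⊤)
  renaming (_∈?_ to _∈ₛ?_)
open import Data.Maybe using (just)
open import Data.Product using (∃; ∃₂; _×_; _,_; proj₁; proj₂)
open import Data.Sum using (_⊎_; inj₁; inj₂)
open import Data.Empty using (⊥; ⊥-elim)
open import Relation.Nullary using (¬_; yes; no; contradiction)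
open import Relation.Binary.Definitions using (tri<; tri≈; tri>)
open import Relation.Binary.PropositionalEquality
open import Data.List using (List; []; _∷_; head; last; length)
open import Data.List.Relation.Unary.Linked using (Linked; [-]; _∷_)
open import Data.List.Relation.Unary.All using ([]; _∷_)
open import Data.List.Relation.Unary.AllPairs using ([]; _∷_)
open import Data.List.Relation.Unary.All.Properties using (¬Any⇒All¬)
open import Data.List.Relation.Unary.Any using (here; there)
open import Data.List.Membership.Propositional using (_∈_; _∉_)
open import Data.List.Relation.Unary.Unique.Propositional using (Unique)
open import Function.Bundles using (Inverse)

uniform-bound : ∀ {m} (P : Fin m → ℕ → Set) → (∀ {i k k'} → k ≤ k' → P i k → P i k') →
                (∀ i → ∃ (P i)) → ∃ λ N → ∀ i → P i N
uniform-bound {zero} P mono bound = 0 , λ ()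
uniform-bound {suc m} P mono bound
  with bound zero | uniform-bound (λ i → P (suc i)) mono (λ i → bound (suc i))
... | k₀ , p₀ | N , p = k₀ ⊔ N , λ where
  zero    → mono (m≤m⊔n k₀ N) p₀
  (suc i) → mono (m≤n⊔m k₀ N) (p i)

three-distinct⇒ordered : ∀ (P : ℕ → Set) → (∀ {i j k} → i < j → j < k → P i → P j → P k → ⊥) →
                         ∀ {i j k} → i ≢ j → j ≢ k → i ≢ k → P i → P j → P k → ⊥
three-distinct⇒ordered P ordered {i} {j} {k} i≢j j≢k i≢k Pi Pj Pk
  with <-cmp i j | <-cmp j k | <-cmp i k
... | tri≈ _ i≡j _ | _              | _              = i≢j i≡j
... | _            | tri≈ _ j≡k _   | _              = j≢k j≡k
... | _            | _              | tri≈ _ i≡k _   = i≢k i≡k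
... | tri< i<j _ _ | tri< j<k _ _   | _              = ordered i<j j<k Pi Pj Pk
... | tri< i<j _ _ | tri> _ _ k<j   | tri< i<k _ _   = ordered i<k k<j Pi Pk Pj
... | tri< i<j _ _ | tri> _ _ k<j   | tri> _ _ k<i   = ordered k<i i<j Pk Pi Pj
... | tri> _ _ j<i | tri< j<k _ _   | tri< i<k _ _   = ordered j<i i<k Pj Pi Pk
... | tri> _ _ j<i | tri< j<k _ _   | tri> _ _ k<i   = ordered j<k k<i Pj Pk Pi
... | tri> _ _ j<i | tri> _ _ k<j   | _              = ordered k<j j<i Pk Pj Pi

module _ {n : ℕ} {C : Set} (G : ColoredGraph n C) where

  open import Data.List.Membership.DecPropositional (_≟_ {n}) using (_∈?_)

  variable
    S : Subset n
    a b u v w x y z : Fin n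
    d i j k m : ℕ
    p : List (Fin n)
    col : C

  Adj-sym : Adj G u v → Adj G v u
  Adj-sym {u} {v} uv = trans (adj-sym G v u) uv

  -- The index is an upper bound on the number of edges: 'wait' pads the length,
  -- so Walk S u v m holds iff the distance from u to v inside S is at most m.
  data Walk (S : Subset n) : Fin n → Fin n → ℕ → Set where
    done : u ∈ₛ S → Walk S u u 0
    wait : Walk S u v m → Walk S u v (suc m)
    step : u ∈ₛ S → Adj G u w → Walk S w v m → Walk S u v (suc m)

  source∈ : Walk S u v m → u ∈ₛ S
  source∈ (done u∈S)     = u∈S
  source∈ (wait ω)       = source∈ ω
  source∈ (step u∈S _ _) = u∈S

  target∈ : Walk S u v m → v ∈ₛ S
  target∈ (done v∈S)   = v∈S
  target∈ (wait ω)     = target∈ ω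
  target∈ (step _ _ ω) = target∈ ω

  Walk-⊆ : ∀ {T} → S ⊆ T → Walk S u v m → Walk T u v m
  Walk-⊆ S⊆T (done u∈S)      = done (S⊆T u∈S)
  Walk-⊆ S⊆T (wait ω)        = wait (Walk-⊆ S⊆T ω)
  Walk-⊆ S⊆T (step u∈S uw ω) = step (S⊆T u∈S) uw (Walk-⊆ S⊆T ω)

  stay : u ∈ₛ S → ∀ m → Walk S u u m
  stay u∈S zero    = done u∈S
  stay u∈S (suc m) = wait (stay u∈S m)

  Walk-mono : ∀ {m m'} → m ≤ m' → Walk S u v m → Walk S u v m'
  Walk-mono {m' = m'} _ (done u∈S)  = stay u∈S m'
  Walk-mono (s≤s m≤m') (wait ω)        = wait (Walk-mono m≤m' ω)
  Walk-mono (s≤s m≤m') (step u∈S uw ω) = step u∈S uw (Walk-mono m≤m' ω)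

  infixr 5 _++ʷ_
  _++ʷ_ : Walk S u v m → Walk S v w k → Walk S u w (m + k)
  done _        ++ʷ ω' = ω'
  wait ω        ++ʷ ω' = wait (ω ++ʷ ω')
  step u∈S uw ω ++ʷ ω' = step u∈S uw (ω ++ʷ ω')

  reverse : Walk S u v m → Walk S v u m
  reverse (done u∈S) = done u∈S
  reverse (wait ω)   = wait (reverse ω)
  reverse {m = suc m} (step u∈S uw ω) =
    subst (Walk _ _ _) (+-comm m 1) (reverse ω ++ʷ step (source∈ ω) (Adj-sym uw) (done u∈S))

  Walk₀⇒≡ : Walk S u v 0 → u ≡ v
  Walk₀⇒≡ (done _) = refl

  record Between (S : Subset n) (x y z : Fin n) : Set where
    constructor between
    field
      d₁ d₂ : ℕ
      left  : Walk S x y (suc d₁)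
      right : Walk S y z (suc d₂)
      tight : ∀ {m} → Walk S x z m → suc d₁ + suc d₂ ≤ m

  Between-sym : Between S x y z → Between S z y x
  Between-sym (between d₁ d₂ xy yz tight) =
    between d₂ d₁ (reverse yz) (reverse xy)
      λ {m} zx → subst (_≤ m) (+-comm (suc d₁) (suc d₂)) (tight (reverse zx))

  Between-apart : Between S x y z → Walk S x z m → 2 ≤ m
  Between-apart (between d₁ d₂ _ _ tight) xz =
    ≤-trans (s≤s (≤-trans (s≤s z≤n) (m≤n+m (suc d₂) d₁))) (tight xz)

  Between-prefix : (β : Between S x y z) → Walk S y w (suc k) → Walk S w z m →
                   suc k + m ≤ suc (Between.d₂ β) → Between S x y w
  Between-prefix {k = k} {m = m} (between d₁ d₂ xy _ tight) yw wz shorter =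
    between d₁ k xy yw λ {m'} xw → +-cancelʳ-≤ m (suc d₁ + suc k) m' (begin
      suc d₁ + suc k + m   ≡⟨ +-assoc (suc d₁) (suc k) m ⟩
      suc d₁ + (suc k + m) ≤⟨ +-monoʳ-≤ (suc d₁) shorter ⟩
      suc d₁ + suc d₂      ≤⟨ tight (xw ++ʷ wz) ⟩
      m' + m               ∎)
    where open ≤-Reasoning

  Quasiconvex : Subset n → Set
  Quasiconvex S = ∀ {x y z w k} → Between S x y z →
                  Walk S x w (suc k) → Walk S z w (suc k) → Walk S y w k

  complete⇒quasiconvex : CompleteOn G S → Quasiconvex S
  complete⇒quasiconvex complete {x} {z = z} β xw zw with x ≟ z
  ... | yes refl = contradiction (Between-apart β (stay (source∈ xw) 0)) λ ()
  ... | no x≢z   = contradiction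
        (Between-apart β (step x∈S (complete x z x∈S z∈S x≢z) (done z∈S))) λ { (s≤s ()) }
    where
      x∈S = source∈ xw
      z∈S = source∈ zw

  Side : Subset n → Fin n → Fin n → Set
  Side A c x = x ∈ₛ A ⊎ x ≡ c

  record CutSplit (S A B : Subset n) (c : Fin n) : Set where
    field
      c∈S      : c ∈ₛ S
      c∉A      : c ∉ₛ A
      c∉B      : c ∉ₛ B
      disjoint : ∀ {x} → x ∈ₛ A → x ∉ₛ B
      cover    : ∀ {x} → x ∈ₛ S → x ∈ₛ A ⊎ x ∈ₛ B ⊎ x ≡ c
      A⊆S      : A ⊆ S
      B⊆S      : B ⊆ S
      no-edge  : ∀ {a b} → a ∈ₛ A → b ∈ₛ B → ¬ Adj G a b

  cutSplit : ∀ {S A B c} → SplitsAs G S A B c →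
             (∀ a b p → a ∈ₛ A → b ∈ₛ B → IsPathIn G S a b p → c ∈ p) → CutSplit S A B c
  cutSplit {S} {A} {B} {c} (c∈S , c∉A , c∉B , disjoint , cover , A⊆S , B⊆S) separates = record
    { c∈S = c∈S ; c∉A = c∉A ; c∉B = c∉B
    ; disjoint = λ {x} → disjoint x
    ; cover    = λ {x} → cover x
    ; A⊆S      = λ {x} → A⊆S x
    ; B⊆S      = λ {x} → B⊆S x
    ; no-edge  = λ {a} {b} a∈A b∈B ab → c∉edge a∈A b∈B
        (separates a b (a ∷ b ∷ []) a∈A b∈B (edge-path a∈A b∈B ab))
    }
    where
      edge-path : a ∈ₛ A → b ∈ₛ B → Adj G a b → IsPathIn G S a b (a ∷ b ∷ [])
      edge-path a∈A b∈B ab =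
        (refl , refl , ab ∷ [-] , ((λ { refl → disjoint _ a∈A b∈B }) ∷ []) ∷ [] ∷ [])
        , A⊆S _ a∈A ∷ B⊆S _ b∈B ∷ []

      c∉edge : a ∈ₛ A → b ∈ₛ B → c ∉ a ∷ b ∷ []
      c∉edge a∈A _ (here refl)         = c∉A a∈A
      c∉edge _ b∈B (there (here refl)) = c∉B b∈B

  CutSplit-swap : ∀ {S A B c} → CutSplit S A B c → CutSplit S B A c
  CutSplit-swap sp = record
    { c∈S = c∈S ; c∉A = c∉B ; c∉B = c∉A
    ; disjoint = λ x∈B x∈A → disjoint x∈A x∈B
    ; cover    = λ x∈S → swap-cover (cover x∈S)
    ; A⊆S = B⊆S ; B⊆S = A⊆S
    ; no-edge  = λ b∈B a∈A ba → no-edge a∈A b∈B (Adj-sym ba)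
    }
    where
      open CutSplit sp
      swap-cover : ∀ {P Q R : Set} → P ⊎ Q ⊎ R → Q ⊎ P ⊎ R
      swap-cover (inj₁ p)        = inj₂ (inj₁ p)
      swap-cover (inj₂ (inj₁ q)) = inj₁ q
      swap-cover (inj₂ (inj₂ r)) = inj₂ (inj₂ r)

  module Cut {S A B : Subset n} {c : Fin n} (sp : CutSplit S A B c) where
    open CutSplit sp

    A⁺ : Subset n
    A⁺ = A ∪ ⁅ c ⁆

    Side⇒∈A⁺ : Side A c x → x ∈ₛ A⁺
    Side⇒∈A⁺ (inj₁ x∈A)  = x∈p∪q⁺ (inj₁ x∈A)
    Side⇒∈A⁺ (inj₂ refl) = x∈p∪q⁺ (inj₂ (x∈⁅x⁆ c))

    A⁺⊆S : A⁺ ⊆ S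
    A⁺⊆S x∈A⁺ with x∈p∪q⁻ A ⁅ c ⁆ x∈A⁺
    ... | inj₁ x∈A = A⊆S x∈A
    ... | inj₂ x∈c rewrite x∈⁅y⁆⇒x≡y c x∈c = c∈S

    Side-or-B : x ∈ₛ S → Side A c x ⊎ x ∈ₛ B
    Side-or-B x∈S with cover x∈S
    ... | inj₁ x∈A        = inj₁ (inj₁ x∈A)
    ... | inj₂ (inj₁ x∈B) = inj₂ x∈B
    ... | inj₂ (inj₂ x≡c) = inj₁ (inj₂ x≡c)

    B∩Side≡∅ : x ∈ₛ B → ¬ Side A c x
    B∩Side≡∅ x∈B (inj₁ x∈A)  = disjoint x∈A x∈B
    B∩Side≡∅ x∈B (inj₂ refl) = c∉B x∈B

    step-from-B : x ∈ₛ B → Adj G x y → y ∈ₛ S → Side B c y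
    step-from-B x∈B xy y∈S with cover y∈S
    ... | inj₁ y∈A  = ⊥-elim (no-edge y∈A x∈B (Adj-sym xy))
    ... | inj₂ y∈B⁺ = y∈B⁺

    B→A-via-cut : Side B c u → Side A c v → Walk S u v m →
                  ∃₂ λ m₁ m₂ → m₁ + m₂ ≡ m × Walk S u c m₁ × Walk S c v m₂
    B→A-via-cut (inj₂ refl) _ ω = 0 , _ , refl , done c∈S , ω
    B→A-via-cut (inj₁ u∈B) v∈A⁺ (done _) = ⊥-elim (B∩Side≡∅ u∈B v∈A⁺)
    B→A-via-cut (inj₁ u∈B) v∈A⁺ (wait ω) with B→A-via-cut (inj₁ u∈B) v∈A⁺ ω
    ... | m₁ , m₂ , sum , uc , cv = suc m₁ , m₂ , cong suc sum , wait uc , cv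
    B→A-via-cut (inj₁ u∈B) v∈A⁺ (step u∈S uw ω)
      with B→A-via-cut (step-from-B u∈B uw (source∈ ω)) v∈A⁺ ω
    ... | m₁ , m₂ , sum , wc , cv = suc m₁ , m₂ , cong suc sum , step u∈S uw wc , cv

    leave-B : u ∈ₛ B → Side A c v → Walk S u v m →
              ∃₂ λ m₁ m₂ → suc m₁ + m₂ ≡ m × Walk S u c (suc m₁) × Walk S c v m₂
    leave-B u∈B v∈A⁺ ω with B→A-via-cut (inj₁ u∈B) v∈A⁺ ω
    ... | zero , _ , _ , uc , _ = ⊥-elim (c∉B (subst (_∈ₛ B) (Walk₀⇒≡ uc) u∈B))
    ... | suc m₁ , m₂ , sum , uc , cv = m₁ , m₂ , sum , uc , cv

    c-closer-than-B : u ∈ₛ B → Side A c v → Walk S u v (suc k) → Walk S c v k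
    c-closer-than-B u∈B v∈A⁺ ω with leave-B u∈B v∈A⁺ ω
    ... | m₁ , m₂ , sum , _ , cv = Walk-mono (subst (m₂ ≤_) (suc-injective sum) (m≤n+m m₂ m₁)) cv

    -- Collapsing B onto c turns a walk in S into a walk of the same length in A ∪ {c}.
    ρ : Fin n → Fin n
    ρ x with x ∈ₛ? B
    ... | yes _ = c
    ... | no _  = x

    ρ-fix : Side A c x → ρ x ≡ x
    ρ-fix {x} x∈A⁺ with x ∈ₛ? B
    ... | yes x∈B = ⊥-elim (B∩Side≡∅ x∈B x∈A⁺)
    ... | no _    = refl

    ρ-∈ : x ∈ₛ S → ρ x ∈ₛ A⁺
    ρ-∈ {x} x∈S with x ∈ₛ? B | Side-or-B x∈S
    ... | yes _   | _          = Side⇒∈A⁺ (inj₂ refl)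
    ... | no _    | inj₁ x∈A⁺  = Side⇒∈A⁺ x∈A⁺
    ... | no x∉B  | inj₂ x∈B   = ⊥-elim (x∉B x∈B)

    B-neighbour≡c : x ∈ₛ B → Adj G x y → y ∈ₛ S → y ∉ₛ B → y ≡ c
    B-neighbour≡c x∈B xy y∈S y∉B with step-from-B x∈B xy y∈S
    ... | inj₁ y∈B = ⊥-elim (y∉B y∈B)
    ... | inj₂ y≡c = y≡c

    ρ-adj : x ∈ₛ S → y ∈ₛ S → Adj G x y → ρ x ≡ ρ y ⊎ Adj G (ρ x) (ρ y)
    ρ-adj {x} {y} x∈S y∈S xy with x ∈ₛ? B | y ∈ₛ? B
    ... | yes _   | yes _   = inj₁ refl
    ... | yes x∈B | no y∉B  = inj₁ (sym (B-neighbour≡c x∈B xy y∈S y∉B))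
    ... | no x∉B  | yes y∈B = inj₁ (B-neighbour≡c y∈B (Adj-sym xy) x∈S x∉B)
    ... | no _    | no _    = inj₂ xy

    retract : Walk S u v m → Walk A⁺ (ρ u) (ρ v) m
    retract (done u∈S) = done (ρ-∈ u∈S)
    retract (wait ω)   = wait (retract ω)
    retract (step u∈S uw ω) with ρ-adj u∈S (source∈ ω) uw
    ... | inj₁ ρu≡ρw = wait (subst (λ t → Walk A⁺ t _ _) (sym ρu≡ρw) (retract ω))
    ... | inj₂ ρuρw  = step (ρ-∈ u∈S) ρuρw (retract ω)

    restrict : Side A c u → Side A c v → Walk S u v m → Walk A⁺ u v m
    restrict u∈A⁺ v∈A⁺ ω =
      subst₂ (λ s t → Walk A⁺ s t _) (ρ-fix u∈A⁺) (ρ-fix v∈A⁺) (retract ω)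

    Between-restrict : Side A c x → Side A c y → Side A c z → Between S x y z → Between A⁺ x y z
    Between-restrict x∈A⁺ y∈A⁺ z∈A⁺ (between d₁ d₂ xy yz tight) =
      between d₁ d₂ (restrict x∈A⁺ y∈A⁺ xy) (restrict y∈A⁺ z∈A⁺ yz) (λ xz → tight (Walk-⊆ A⁺⊆S xz))

    Between-Side : Side A c x → Side A c z → Between S x y z → Side A c y
    Between-Side x∈A⁺ z∈A⁺ (between d₁ d₂ xy yz tight) with Side-or-B (source∈ yz)
    ... | inj₁ y∈A⁺ = y∈A⁺
    ... | inj₂ y∈B with leave-B y∈B x∈A⁺ (reverse xy) | leave-B y∈B z∈A⁺ yz
    ...   | p₁ , q₁ , sum₁ , _ , cx | p₂ , q₂ , sum₂ , _ , cz =
      contradiction (subst₂ (λ l r → l + r ≤ q₁ + q₂) (sym sum₁) (sym sum₂) (tight (reverse cx ++ʷ cz)))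
        (<⇒≱ (+-mono-<-≤ (s≤s (m≤n+m q₁ p₁)) (m≤n+m q₂ (suc p₂))))

  module Halves {S A B : Subset n} {c : Fin n} (sp : CutSplit S A B c) where
    open Cut sp
    open Cut (CutSplit-swap sp) using ()
      renaming (B→A-via-cut to A→B-via-cut; leave-B to leave-A; c-closer-than-B to c-closer-than-A)

    via-cut : ∀ {P t} → Quasiconvex A⁺ → Side A c x → Side A c y → Side A c z → Between S x y z →
              Walk S x c P → Walk S z c P → Walk S c w t → P + t ≡ suc k → Walk S y w k
    via-cut {P = zero} _ _ _ _ β xc zc _ _ = contradiction (Between-apart β (xc ++ʷ reverse zc)) λ ()
    via-cut {P = suc P} qA x∈A⁺ y∈A⁺ z∈A⁺ β xc zc cw sum =
      subst (Walk S _ _) (suc-injective sum)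
        (Walk-⊆ A⁺⊆S (qA (Between-restrict x∈A⁺ y∈A⁺ z∈A⁺ β)
                         (restrict x∈A⁺ (inj₂ refl) xc) (restrict z∈A⁺ (inj₂ refl) zc))
         ++ʷ cw)

    same-side : Quasiconvex A⁺ → Side A c x → Side A c z → Between S x y z →
                Walk S x w (suc k) → Walk S z w (suc k) → Walk S y w k
    same-side qA x∈A⁺ z∈A⁺ β xw zw with Between-Side x∈A⁺ z∈A⁺ β | Side-or-B (target∈ xw)
    ... | y∈A⁺ | inj₁ w∈A⁺ =
      Walk-⊆ A⁺⊆S (qA (Between-restrict x∈A⁺ y∈A⁺ z∈A⁺ β) (restrict x∈A⁺ w∈A⁺ xw) (restrict z∈A⁺ w∈A⁺ zw))
    ... | y∈A⁺ | inj₂ w∈B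
      with A→B-via-cut x∈A⁺ (inj₁ w∈B) xw | A→B-via-cut z∈A⁺ (inj₁ w∈B) zw
    ...   | P₁ , t₁ , sum₁ , xc , cw₁ | P₂ , t₂ , sum₂ , zc , cw₂ with ≤-total P₂ P₁
    ...     | inj₁ P₂≤P₁ = via-cut qA x∈A⁺ y∈A⁺ z∈A⁺ β xc (Walk-mono P₂≤P₁ zc) cw₁ sum₁
    ...     | inj₂ P₁≤P₂ = via-cut qA z∈A⁺ y∈A⁺ x∈A⁺ (Between-sym β) zc (Walk-mono P₁≤P₂ xc) cw₂ sum₂

    at-cut : x ∈ₛ A → z ∈ₛ B → Walk S x w (suc k) → Walk S z w (suc k) → Walk S c w k
    at-cut x∈A z∈B xw zw with Side-or-B (target∈ xw)
    ... | inj₁ w∈A⁺ = c-closer-than-B z∈B w∈A⁺ zw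
    ... | inj₂ w∈B  = c-closer-than-A x∈A (inj₁ w∈B) xw

    -- The geodesic from y to z ∈ B runs through c, so y lies between x and c as well.
    cross-A : Quasiconvex A⁺ → x ∈ₛ A → y ∈ₛ A → z ∈ₛ B → Between S x y z →
              Walk S x w (suc k) → Walk S z w (suc k) → Walk S y w k
    cross-A {k = k} qA x∈A y∈A z∈B β xw zw with leave-A y∈A (inj₁ z∈B) (Between.right β)
    ... | r , s , sum , yc , cz with Side-or-B (target∈ xw)
    ...   | inj₁ w∈A⁺ =
      Walk-⊆ A⁺⊆S (qA (Between-restrict (inj₁ x∈A) (inj₁ y∈A) (inj₂ refl) (Between-prefix β yc cz (≤-reflexive sum)))
                      (restrict (inj₁ x∈A) w∈A⁺ xw)
                      (restrict (inj₂ refl) w∈A⁺ (Walk-mono (n≤1+n k) (c-closer-than-B z∈B w∈A⁺ zw))))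
    ...   | inj₂ w∈B with A→B-via-cut (inj₁ x∈A) (inj₁ w∈B) xw
    ...     | m₁ , m₂ , sum' , xc , cw =
      Walk-mono (shortcut (Between.tight (Between-prefix β yc cz (≤-reflexive sum)) xc) sum') (yc ++ʷ cw)
      where
        shortcut : ∀ {a l} → suc a + l ≤ m₁ → m₁ + m₂ ≡ suc k → l + m₂ ≤ k
        shortcut {a} {l} a+l≤m₁ sum = ≤-pred (begin
          suc (l + m₂)       ≤⟨ s≤s (m≤n+m (l + m₂) a) ⟩
          suc (a + (l + m₂)) ≡⟨ cong suc (+-assoc a l m₂) ⟨
          suc a + l + m₂     ≤⟨ +-monoˡ-≤ m₂ a+l≤m₁ ⟩
          m₁ + m₂            ≡⟨ sum ⟩
          suc k              ∎)
          where open ≤-Reasoning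

  crossing : ∀ {S A B c} → CutSplit S A B c → Quasiconvex (A ∪ ⁅ c ⁆) → Quasiconvex (B ∪ ⁅ c ⁆) →
             x ∈ₛ A → z ∈ₛ B → Between S x y z →
             Walk S x w (suc k) → Walk S z w (suc k) → Walk S y w k
  crossing sp qA qB x∈A z∈B β xw zw with CutSplit.cover sp (target∈ (Between.left β))
  ... | inj₁ y∈A        = Halves.cross-A sp qA x∈A y∈A z∈B β xw zw
  ... | inj₂ (inj₂ refl) = Halves.at-cut sp x∈A z∈B xw zw
  ... | inj₂ (inj₁ y∈B) = Halves.cross-A (CutSplit-swap sp) qB z∈B y∈B x∈A (Between-sym β) zw xw

  split⇒quasiconvex : ∀ {S A B c} → CutSplit S A B c →
                      Quasiconvex (A ∪ ⁅ c ⁆) → Quasiconvex (B ∪ ⁅ c ⁆) → Quasiconvex S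
  split⇒quasiconvex sp qA qB β xw zw
    with Cut.Side-or-B sp (source∈ xw) | Cut.Side-or-B sp (source∈ zw)
  ... | inj₁ x∈A⁺        | inj₁ z∈A⁺        = Halves.same-side sp qA x∈A⁺ z∈A⁺ β xw zw
  ... | inj₁ (inj₁ x∈A)  | inj₂ z∈B         = crossing sp qA qB x∈A z∈B β xw zw
  ... | inj₁ (inj₂ x≡c)  | inj₂ z∈B         = Halves.same-side (CutSplit-swap sp) qB (inj₂ x≡c) (inj₁ z∈B) β xw zw
  ... | inj₂ x∈B         | inj₁ (inj₁ z∈A)  = crossing (CutSplit-swap sp) qB qA x∈B z∈A β xw zw
  ... | inj₂ x∈B         | inj₁ (inj₂ z≡c)  = Halves.same-side (CutSplit-swap sp) qB (inj₁ x∈B) (inj₂ z≡c) β xw zw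
  ... | inj₂ x∈B         | inj₂ z∈B         = Halves.same-side (CutSplit-swap sp) qB (inj₁ x∈B) (inj₁ z∈B) β xw zw

  mutual
    block⇒quasiconvex : BlockOn G S → Quasiconvex S
    block⇒quasiconvex (split A B c splits separates halfA halfB) =
      split⇒quasiconvex (cutSplit splits separates) (half⇒quasiconvex halfA) (half⇒quasiconvex halfB)

    half⇒quasiconvex : CompleteOn G S ⊎ BlockOn G S → Quasiconvex S
    half⇒quasiconvex (inj₁ complete) = complete⇒quasiconvex complete
    half⇒quasiconvex (inj₂ block)    = block⇒quasiconvex block

  data _[_]=_ : List (Fin n) → ℕ → Fin n → Set where
    here  : (a ∷ p) [ 0 ]= a
    there : p [ i ]= b → (a ∷ p) [ suc i ]= b

  ∈⇒[]= : x ∈ p → ∃ λ i → p [ i ]= x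
  ∈⇒[]= (here refl) = 0 , here
  ∈⇒[]= (there x∈p) with ∈⇒[]= x∈p
  ... | i , px = suc i , there px

  []=-functional : p [ i ]= x → p [ i ]= y → x ≡ y
  []=-functional here       here       = refl
  []=-functional (there px) (there py) = []=-functional px py

  []=-≢ : p [ i ]= x → p [ j ]= y → x ≢ y → i ≢ j
  []=-≢ px py x≢y refl = x≢y ([]=-functional px py)

  head⇒[0]= : head p ≡ just u → p [ 0 ]= u
  head⇒[0]= {_ ∷ _} refl = here

  last⇒[]= : last p ≡ just v → ∃ λ l → p [ l ]= v × suc l ≡ length p
  last⇒[]= {_ ∷ []} refl = 0 , here , refl
  last⇒[]= {_ ∷ _ ∷ _} lastv with last⇒[]= lastv
  ... | l , pv , len = suc l , there pv , cong suc len

  []=⇒< : p [ i ]= x → i < length p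
  []=⇒< here       = s≤s z≤n
  []=⇒< (there px) = s≤s ([]=⇒< px)

  segment : Linked (Adj G) p → p [ i ]= a → p [ i + d ]= b → Walk ⊤ a b d
  segment _         here       here       = done ∈⊤
  segment (ab ∷ lk) here       (there pb) = step ∈⊤ ab (segment lk here pb)
  segment [-]       here       (there ())
  segment (_ ∷ lk)  (there pa) (there pb) = segment lk pa pb
  segment [-]       (there ()) _

  path⇒walk : IsPath G u v p → ∃ (Walk ⊤ u v)
  path⇒walk (headu , lastv , lk , _) with last⇒[]= lastv
  ... | l , pv , _ = l , segment lk (head⇒[0]= headu) pv

  suffix-path : u ∈ p → last p ≡ just v → Linked (Adj G) p → Unique p →
                ∃ λ q → IsPath G u v q × length q ≤ length p
  suffix-path (here refl) lastv lk unique = _ , (refl , lastv , lk , unique) , ≤-refl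
  suffix-path {p = _ ∷ _ ∷ _} (there u∈p) lastv (_ ∷ lk) (_ ∷ unique)
    with suffix-path u∈p lastv lk unique
  ... | q , path , shorter = q , path , m≤n⇒m≤1+n shorter

  prepend : Adj G u w → IsPath G w v p → u ∉ p → IsPath G u v (u ∷ p)
  prepend {p = _ ∷ _} uw (refl , lastv , lk , unique) u∉p =
    refl , lastv , uw ∷ lk , ¬Any⇒All¬ _ u∉p ∷ unique

  walk⇒path : Walk ⊤ u v m → ∃ λ p → IsPath G u v p × length p ≤ suc m
  walk⇒path (done {u} _) = u ∷ [] , (refl , refl , [-] , [] ∷ []) , ≤-refl
  walk⇒path (wait ω) with walk⇒path ω
  ... | p , path , short = p , path , m≤n⇒m≤1+n short
  walk⇒path {u} (step _ uw ω) with walk⇒path ω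
  ... | p , path@(_ , lastv , lk , unique) , short with u ∈? p
  ...   | no u∉p  = u ∷ p , prepend uw path u∉p , s≤s short
  ...   | yes u∈p with suffix-path u∈p lastv lk unique
  ...     | q , path' , shorter = q , path' , ≤-trans shorter (m≤n⇒m≤1+n short)

  shortest-segment : IsShortestPath G u v p → p [ i ]= x → p [ i + d ]= z → Walk ⊤ x z m → d ≤ m
  shortest-segment {v = v} {p = p} {i} {d = d} {m = m} ((headu , lastv , lk , _) , minimal) px pz xz
    with last⇒[]= lastv
  ... | l , pv , len with m≤n⇒∃[o]m+o≡n (≤-pred (subst (_ <_) (sym len) ([]=⇒< pz)))
  ... | e , i+d+e≡l with walk⇒path (segment lk (head⇒[0]= headu) px ++ʷ xz ++ʷ
                                     segment lk pz (subst (p [_]= v) (sym i+d+e≡l) pv))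
  ... | q , path , short =
    +-cancelʳ-≤ e d m (+-cancelˡ-≤ i (d + e) (m + e) (≤-pred (begin
      suc (i + (d + e)) ≡⟨ cong suc (+-assoc i d e) ⟨
      suc (i + d + e)   ≡⟨ cong suc i+d+e≡l ⟩
      suc l             ≡⟨ len ⟩
      length p          ≤⟨ minimal q path ⟩
      length q          ≤⟨ short ⟩
      suc (i + (m + e)) ∎)))
    where open ≤-Reasoning

  <⇒∃+suc : i < j → ∃ λ d → i + suc d ≡ j
  <⇒∃+suc {i} i<j with m≤n⇒∃[o]m+o≡n i<j
  ... | d , sum = d , trans (+-suc i d) sum

  shortest⇒Between : IsShortestPath G u v p → i < j → j < k →
                     p [ i ]= x → p [ j ]= y → p [ k ]= z → Between ⊤ x y z
  shortest⇒Between {p = p} {i} {z = z} shortest i<j j<k px py pz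
    with <⇒∃+suc i<j | <⇒∃+suc j<k
  ... | d₁ , refl | d₂ , refl =
    between d₁ d₂ (segment lk px py) (segment lk py pz)
      (shortest-segment shortest px (subst (p [_]= z) (+-assoc i (suc d₁) (suc d₂)) pz))
    where lk = proj₁ (proj₂ (proj₂ (proj₁ shortest)))

  Walk-aut : (σ : Aut G) → Walk ⊤ u v m →
             Walk ⊤ (Inverse.to (proj₁ σ) u) (Inverse.to (proj₁ σ) v) m
  Walk-aut σ (done _)      = done ∈⊤
  Walk-aut σ (wait ω)      = wait (Walk-aut σ ω)
  Walk-aut σ (step _ uw ω) = step ∈⊤ (trans (proj₁ (proj₂ σ) _ _) uw) (Walk-aut σ ω)

  Ecc≤ : Fin n → ℕ → Set
  Ecc≤ y k = ∀ w → Walk ⊤ y w k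

  Ecc≤-transfer : RCOP G → vcol G u ≡ vcol G v → Ecc≤ u k → Ecc≤ v k
  Ecc≤-transfer (_ , vertex-orbits , _) same ecc w with vertex-orbits _ _ same
  ... | σ , refl = subst (λ t → Walk ⊤ _ t _) (Inverse.strictlyInverseˡ (proj₁ σ) w)
                     (Walk-aut σ (ecc (Inverse.from (proj₁ σ) w)))

  Ecc≤-exists : Connected G → ∀ y → ∃ (Ecc≤ y)
  Ecc≤-exists connected y =
    uniform-bound (λ w k → Walk ⊤ y w k) Walk-mono (λ w → path⇒walk (proj₂ (connected y w)))

  monochrome-interior⇒¬Ecc≤ : RCOP G → Quasiconvex ⊤ → Between ⊤ x y z →
                           vcol G y ≡ vcol G x → vcol G y ≡ vcol G z → ∀ k → ¬ Ecc≤ y k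
  monochrome-interior⇒¬Ecc≤ rcop qc β yx yz zero ecc =
    contradiction (Between-apart β (Ecc≤-transfer rcop yx ecc _)) λ ()
  monochrome-interior⇒¬Ecc≤ rcop qc β yx yz (suc k) ecc =
    monochrome-interior⇒¬Ecc≤ rcop qc β yx yz k λ w →
      qc β (Ecc≤-transfer rcop yx ecc w) (Ecc≤-transfer rcop yz ecc w)

  ordered-monochrome⇒⊥ : Connected G → RCOP G → IsBlockGraph G → IsShortestPath G u v p →
                         i < j → j < k → p [ i ]= x → p [ j ]= y → p [ k ]= z →
                         vcol G x ≡ col → vcol G y ≡ col → vcol G z ≡ col → ⊥
  ordered-monochrome⇒⊥ {y = y} connected rcop block shortest i<j j<k px py pz xc yc zc =
    monochrome-interior⇒¬Ecc≤ rcop (block⇒quasiconvex block) (shortest⇒Between shortest i<j j<k px py pz)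
      (trans yc (sym xc)) (trans yc (sym zc)) (proj₁ ecc) (proj₂ ecc)
    where ecc = Ecc≤-exists connected y

lemma4p5 : ∀ {n : ℕ} {C : Set} (G : ColoredGraph n C) →
    Connected G → RCOP G → IsBlockGraph G →
    ∀ (u v : Fin n) (p : List (Fin n)) → IsShortestPath G u v p →
    ∀ (x y z : Fin n) → x ∈ p → y ∈ p → z ∈ p →
      x ≢ y → y ≢ z → x ≢ z →
      vcol G x ≡ vcol G y → vcol G y ≡ vcol G z → ⊥
lemma4p5 G connected rcop block u v p shortest x y z x∈p y∈p z∈p x≢y y≢z x≢z xy yz
  with ∈⇒[]= G x∈p | ∈⇒[]= G y∈p | ∈⇒[]= G z∈p
... | i , px | j , py | k , pz =
  three-distinct⇒ordered OfColour ordered ([]=-≢ G px py x≢y) ([]=-≢ G py pz y≢z) ([]=-≢ G px pz x≢z)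
    (x , px , xy) (y , py , refl) (z , pz , sym yz)
  where
    OfColour : ℕ → Set
    OfColour l = ∃ λ w → _[_]=_ G p l w × vcol G w ≡ vcol G y

    ordered : ∀ {i j k} → i < j → j < k → OfColour i → OfColour j → OfColour k → ⊥
    ordered i<j j<k (_ , pa , ac) (_ , pb , bc) (_ , pc , cc) =
      ordered-monochrome⇒⊥ G connected rcop block shortest i<j j<k pa pb pc ac bc cc
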